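{- Let $V$ be a finite set of size $v$ and let $(\mathfrak{P}_0,\ldots,\mathfrak{P}_v)$ be a tactical sequence of partitions on $V$. Let $x,y,z\in\{0,\ldots,v\}$ be integers with $x\leq y\leq z$. Then \[W^{(xy)}W^{(yz)}=\binom{z-x}{y-x}W^{(xz)}.\]
   Context: $\binom{V}{x}$ is the set of $x$-subsets of $V$; each $\mathfrak{P}_x$ is a partition of $\binom{V}{x}$. $(\mathfrak{P}_0,\ldots,\mathfrak{P}_v)$ is a tactical sequence of partitions if for all $x\le y$ and all parts $\mathcal{X}\in\mathfrak{P}_x,\mathcal{Y}\in\mathfrak{P}_y$, the number $\#\{Y\in\mathcal{Y}\mid X\subseteq Y\}$ does not depend on $X\in\mathcal{X}$ and $\#\{X\in\mathcal{X}\mid X\subseteq Y\}$ does not depend on $Y\in\mathcal{Y}$; these values define $R^{(xy)}_{\mathcal{X},\mathcal{Y}}=\#\{Y\in\mathcal{Y}\mid X\subseteq Y\}$ (any $X\in\mathcal{X}$), a matrix in $\mathbb{Z}^{\mathfrak{P}_x\times\mathfrak{P}_y}$. $D^{(x)}$ is the diagonal $\mathfrak{P}_x\times\mathfrak{P}_x$ matrix with entries $D^{(x)}_{\mathcal{X},\mathcal{X}}=\#\mathcal{X}$, and $\sqrt{D^{(x)}}$ is the diagonal matrix of positive square roots of these entries. For $0\le x\le y\le v$, $W^{(xy)}=\sqrt{D^{(x)}}\,R^{(xy)}\,\sqrt{D^{(y)}}^{ -1}$. -}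

module Defs where

open import Level using (Level)
open import Data.Nat using (ℕ; zero; suc; _≤_; _<_; _∸_)
open import Data.Nat.Properties using (_≟_)
open import Data.Nat.Combinatorics using (_C_)
open import Data.Fin using (Fin)
import Data.Fin.Properties as FinP
open import Data.Fin.Subset using (Subset; ∣_∣; _⊆_; inside; outside)
open import Data.Fin.Subset.Properties using (_⊆?_)
open import Data.Vec using ([]; _∷_)
open import Data.List using (List; []; _∷_; _++_; map; length; filter)
open import Data.Maybe using (Maybe; just; nothing)
import Data.Maybe.Properties as MaybeP
open import Data.Product using (Σ; ∃; _×_; _,_; proj₁)
open import Relation.Nullary using (yes; no; Dec)
open import Relation.Nullary.Decidable using (_×-dec_)
open import Relation.Unary using (Pred; Decidable)
open import Relation.Binary.PropositionalEquality using (_≡_; refl)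
open import Algebra.Bundles using (CommutativeRing; Semiring)
import Algebra.Properties.Monoid.Sum as MonoidSum
import Algebra.Definitions.RawSemiring as RS

allSubsets : (v : ℕ) → List (Subset v)
allSubsets zero    = [] ∷ []
allSubsets (suc v) = map (outside ∷_) (allSubsets v) ++ map (inside ∷_) (allSubsets v)

count : ∀ {v} (P : Pred (Subset v) Level.zero) → Decidable P → ℕ
count {v} P P? = length (filter P? (allSubsets v))

module PartMembership {v : ℕ} (nParts : ℕ → ℕ) (cls : (S : Subset v) → Fin (nParts ∣ S ∣)) where
  partOf : (k : ℕ) → Subset v → Maybe (Fin (nParts k))
  partOf k S with ∣ S ∣ ≟ k
  ... | yes refl = just (cls S)
  ... | no _     = nothing

  _∈Part_ : Subset v → Σ ℕ (λ k → Fin (nParts k)) → Set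
  S ∈Part (k , i) = partOf k S ≡ just i

  _∈Part?_ : (S : Subset v) (p : Σ ℕ (λ k → Fin (nParts k))) → Dec (S ∈Part p)
  S ∈Part? (k , i) = MaybeP.≡-dec FinP._≟_ (partOf k S) (just i)

-- A sequence of partitions (𝔓_k)_k of the k-subsets of V = Fin v.
-- For each k, 𝔓_k has `nParts k` parts, labelled by Fin (nParts k);
-- `cls S` is the part of 𝔓_{|S|} containing S.  Parts are nonempty
-- (`nonempty` gives, for each part, a member of it), so every part
-- label is a genuine block of the partition (for k > v there are no
-- k-subsets, hence no parts).
record PartitionSeq (v : ℕ) : Set where
  field
    nParts   : ℕ → ℕ
    cls      : (S : Subset v) → Fin (nParts ∣ S ∣)
    nonempty : (k : ℕ) (i : Fin (nParts k)) →
               ∃ λ S → PartMembership._∈Part_ nParts cls S (k , i)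

  open PartMembership nParts cls public

  rep : (k : ℕ) → Fin (nParts k) → Subset v
  rep k i = proj₁ (nonempty k i)

  upCount : (X : Subset v) (y : ℕ) (j : Fin (nParts y)) → ℕ
  upCount X y j = count (λ Y → (Y ∈Part (y , j)) × (X ⊆ Y))
                        (λ Y → (Y ∈Part? (y , j)) ×-dec (X ⊆? Y))

  downCount : (x : ℕ) (i : Fin (nParts x)) (Y : Subset v) → ℕ
  downCount x i Y = count (λ X → (X ∈Part (x , i)) × (X ⊆ Y))
                          (λ X → (X ∈Part? (x , i)) ×-dec (X ⊆? Y))

  partSize : (x : ℕ) → Fin (nParts x) → ℕ
  partSize x i = count (λ X → X ∈Part (x , i)) (λ X → X ∈Part? (x , i))

  -- R^{(xy)}_{𝒳,𝒴} = #{Y ∈ 𝒴 | X ⊆ Y} for any (here: a chosen) X ∈ 𝒳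
  R : (x y : ℕ) → Fin (nParts x) → Fin (nParts y) → ℕ
  R x y i j = upCount (rep x i) y j

record IsTactical {v : ℕ} (𝔓 : PartitionSeq v) : Set where
  open PartitionSeq 𝔓
  field
    up-const   : (x y : ℕ) → x ≤ y → (i : Fin (nParts x)) (j : Fin (nParts y))
                 (X X′ : Subset v) → X ∈Part (x , i) → X′ ∈Part (x , i) →
                 upCount X y j ≡ upCount X′ y j
    down-const : (x y : ℕ) → x ≤ y → (i : Fin (nParts x)) (j : Fin (nParts y))
                 (Y Y′ : Subset v) → Y ∈Part (y , j) → Y′ ∈Part (y , j) →
                 downCount x i Y ≡ downCount x i Y′

ringℕ : ∀ {c ℓ} (Rg : CommutativeRing c ℓ) → ℕ → CommutativeRing.Carrier Rg
ringℕ Rg n = RS._×_ (Semiring.rawSemiring (CommutativeRing.semiring Rg)) n (CommutativeRing.1# Rg)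

record SqrtData {c ℓ} (Rg : CommutativeRing c ℓ) : Set (c Level.⊔ ℓ) where
  open CommutativeRing Rg
  field
    sq     : ℕ → Carrier
    sqInv  : ℕ → Carrier
    sq-sq  : ∀ n → sq n * sq n ≈ ringℕ Rg n
    sq-inv : ∀ n → 0 < n → sq n * sqInv n ≈ 1#

module _ {c ℓ} (Rg : CommutativeRing c ℓ) (sd : SqrtData Rg) {v : ℕ} (𝔓 : PartitionSeq v) where
  open CommutativeRing Rg
  open SqrtData sd
  open PartitionSeq 𝔓

  W : (x y : ℕ) → Fin (nParts x) → Fin (nParts y) → Carrier
  W x y i j = sq (partSize x i) * ringℕ Rg (R x y i j) * sqInv (partSize y j)

  WW : (x y z : ℕ) → Fin (nParts x) → Fin (nParts z) → Carrier
  WW x y z i k = MonoidSum.sum +-monoid (λ j → W x y i j * W y z j k)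

-- The factors √#𝒴 and √#𝒴⁻¹ cancel in each term of the matrix product, so it suffices to
-- prove Σ_𝒴 R^{(xy)}_{𝒳𝒴} R^{(yz)}_{𝒴𝒵} = C(z−x, y−x) R^{(xz)}_{𝒳𝒵} in ℕ.  Fix X ∈ 𝒳.
-- Since #{Z ∈ 𝒵 | Y ⊆ Z} is the same for all Y in a part 𝒴, and the parts of 𝔓_y
-- partition the y-subsets, the left side counts pairs (Y, Z) with X ⊆ Y ⊆ Z, |Y| = y and
-- Z ∈ 𝒵.  For each Z ⊇ X in 𝒵 there are C(z−x, y−x) such Y, giving the right side.

module Submission where

open import Defs
open import Level using (Level; 0ℓ)
open import Data.Nat using (ℕ; _≤_; _∸_)
import Data.Nat as ℕ
import Data.Nat.Properties as ℕ
open import Data.Nat.Combinatorics using (_C_)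
open import Data.Fin using (Fin)
open import Function.Base using (_∘_)
open import Relation.Binary.PropositionalEquality using (cong)
open import Algebra.Bundles using (CommutativeRing)
import Algebra.Properties.Semiring.Sum as SemiringSum
import Algebra.Properties.Semiring.Mult as SemiringMult
import Algebra.Solver.CommutativeMonoid as CMSolver
import Relation.Binary.Reasoning.Setoid as SetoidReasoning

module ℕΣ = SemiringSum ℕ.+-*-semiring

module Counting where

  open import Data.Bool.Base using (true; false; if_then_else_)
  open import Data.Nat using (zero; suc; _+_; _*_; _<_)
  open import Data.Nat.Properties
  open import Algebra.Properties.CommutativeSemigroup +-commutativeSemigroup using (interchange)
  open import Data.Nat.Combinatorics using (nCk+nC[k+1]≡[n+1]C[k+1])
  open import Data.Nat.Solver using (module +-*-Solver)
  open import Data.Fin as Fin using (zero; suc)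
  open import Data.Fin.Subset using (Subset; ∣_∣; _⊆_; inside; outside)
  open import Data.Fin.Subset.Properties using (_⊆?_; drop-∷-⊆; ⊆-trans; p⊆q⇒∣p∣≤∣q∣)
  open import Data.Vec.Base using ([]; _∷_; here)
  open import Data.List.Base using (List; []; _∷_; _++_; map; length; filter)
  open import Data.List.Properties using (filter-some)
  open import Data.List.Membership.Propositional using (_∈_; lose)
  open import Data.List.Membership.Propositional.Properties using (∈-++⁺ˡ; ∈-++⁺ʳ; ∈-map⁺)
  open import Data.List.Relation.Unary.Any using (here)
  open import Data.Product using (_,_; proj₂)
  open import Function.Base using (_⟨_⟩_; case_of_)
  open import Relation.Nullary using (Dec; yes; no; does; ¬_; contradiction)
  open import Relation.Nullary.Decidable using (dec-true; dec-false; _×-dec_)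
  open import Relation.Unary using (Pred; Decidable)
  open import Relation.Binary.PropositionalEquality
  open ℕΣ using (sum-syntax; sum-cong-≗; sum-replicate-zero; *-distribʳ-sum)

  open ≡-Reasoning

  private
    variable
      p q : Level
      A B : Set
      P : Set p
      Q : Set q

  -- Defined through `does`, so that 𝟙 (m ≟ n), 𝟙 (i Fin.≟ j) and 𝟙 (p ⊆? q) compute on
  -- constructor heads; many steps below hold by definition.
  𝟙 : Dec P → ℕ
  𝟙 d = if does d then 1 else 0

  𝟙-yes : (d : Dec P) → P → 𝟙 d ≡ 1
  𝟙-yes d p = cong (if_then 1 else 0) (dec-true d p)

  𝟙-no : (d : Dec P) → ¬ P → 𝟙 d ≡ 0
  𝟙-no d ¬p = cong (if_then 1 else 0) (dec-false d ¬p)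

  𝟙-× : (d : Dec P) (e : Dec Q) → 𝟙 (d ×-dec e) ≡ 𝟙 d * 𝟙 e
  𝟙-× d e with does d
  ... | true  = sym (+-identityʳ (𝟙 e))
  ... | false = refl

  𝟙-*-cong : (d : Dec P) {m n : ℕ} → (P → m ≡ n) → 𝟙 d * m ≡ 𝟙 d * n
  𝟙-*-cong (yes p) m≡n = cong (1 *_) (m≡n p)
  𝟙-*-cong (no _)  _   = refl

  ∑ₗ : List A → (A → ℕ) → ℕ
  ∑ₗ []       f = 0
  ∑ₗ (a ∷ as) f = f a + ∑ₗ as f

  infix 10 ∑ₗ
  syntax ∑ₗ L (λ a → e) = ∑[ a ∈ L ] e

  ∑ₗ-cong : (L : List A) {f g : A → ℕ} → (∀ a → f a ≡ g a) → ∑ₗ L f ≡ ∑ₗ L g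
  ∑ₗ-cong []      f≡g = refl
  ∑ₗ-cong (a ∷ L) f≡g = cong₂ _+_ (f≡g a) (∑ₗ-cong L f≡g)

  ∑ₗ-zero : (L : List A) {f : A → ℕ} → (∀ a → f a ≡ 0) → ∑ₗ L f ≡ 0
  ∑ₗ-zero L f≡0 = ∑ₗ-cong L f≡0 ⟨ trans ⟩ zeros L
    where
    zeros : (L : List A) → ∑[ _ ∈ L ] 0 ≡ 0
    zeros []      = refl
    zeros (_ ∷ L) = zeros L

  ∑ₗ-++ : (L M : List A) (f : A → ℕ) → ∑ₗ (L ++ M) f ≡ ∑ₗ L f + ∑ₗ M f
  ∑ₗ-++ []      M f = refl
  ∑ₗ-++ (a ∷ L) M f = cong (f a +_) (∑ₗ-++ L M f) ⟨ trans ⟩ sym (+-assoc (f a) _ _)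

  ∑ₗ-map : (g : B → A) (L : List B) (f : A → ℕ) → ∑ₗ (map g L) f ≡ ∑ₗ L (f ∘ g)
  ∑ₗ-map g []      f = refl
  ∑ₗ-map g (b ∷ L) f = cong (f (g b) +_) (∑ₗ-map g L f)

  ∑ₗ-distrib-+ : (L : List A) (f g : A → ℕ) → ∑[ a ∈ L ] (f a + g a) ≡ ∑ₗ L f + ∑ₗ L g
  ∑ₗ-distrib-+ []      f g = refl
  ∑ₗ-distrib-+ (a ∷ L) f g = cong (f a + g a +_) (∑ₗ-distrib-+ L f g) ⟨ trans ⟩ interchange (f a) (g a) _ _

  *-distribʳ-∑ₗ : (L : List A) (f : A → ℕ) (c : ℕ) → ∑ₗ L f * c ≡ ∑[ a ∈ L ] (f a * c)
  *-distribʳ-∑ₗ []      f c = refl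
  *-distribʳ-∑ₗ (a ∷ L) f c = *-distribʳ-+ c (f a) _ ⟨ trans ⟩ cong (f a * c +_) (*-distribʳ-∑ₗ L f c)

  *-distribˡ-∑ₗ : (L : List A) (f : A → ℕ) (c : ℕ) → c * ∑ₗ L f ≡ ∑[ a ∈ L ] (c * f a)
  *-distribˡ-∑ₗ L f c = *-comm c _ ⟨ trans ⟩ *-distribʳ-∑ₗ L f c ⟨ trans ⟩ ∑ₗ-cong L (λ a → *-comm (f a) c)

  ∑ₗ-comm : (L : List A) (M : List B) (g : A → B → ℕ) →
            ∑[ a ∈ L ] ∑ₗ M (g a) ≡ ∑[ b ∈ M ] ∑[ a ∈ L ] g a b
  ∑ₗ-comm []      M g = sym (∑ₗ-zero M (λ _ → refl))
  ∑ₗ-comm (a ∷ L) M g = cong (∑ₗ M (g a) +_) (∑ₗ-comm L M g) ⟨ trans ⟩ sym (∑ₗ-distrib-+ M (g a) _)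

  length-filter≡∑ₗ : {P : Pred A p} (P? : Decidable P) (L : List A) →
                     length (filter P? L) ≡ ∑[ a ∈ L ] 𝟙 (P? a)
  length-filter≡∑ₗ P? []      = refl
  length-filter≡∑ₗ P? (a ∷ L) with does (P? a)
  ... | true  = cong suc (length-filter≡∑ₗ P? L)
  ... | false = length-filter≡∑ₗ P? L

  ∑-∑ₗ-comm : ∀ n (L : List A) (g : Fin n → A → ℕ) →
              ∑[ j < n ] ∑ₗ L (g j) ≡ ∑[ a ∈ L ] ∑[ j < n ] g j a
  ∑-∑ₗ-comm zero    L g = sym (∑ₗ-zero L (λ _ → refl))
  ∑-∑ₗ-comm (suc n) L g =
    cong (∑ₗ L (g zero) +_) (∑-∑ₗ-comm n L (g ∘ suc)) ⟨ trans ⟩ sym (∑ₗ-distrib-+ L (g zero) _)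

  ∑-𝟙-≟ : ∀ {n} (i : Fin n) → ∑[ j < n ] 𝟙 (i Fin.≟ j) ≡ 1
  ∑-𝟙-≟ {suc n} zero    = cong suc (sum-replicate-zero n)
  ∑-𝟙-≟ {suc n} (suc i) = ∑-𝟙-≟ i

  ∈-allSubsets : ∀ {v} (S : Subset v) → S ∈ allSubsets v
  ∈-allSubsets []            = here refl
  ∈-allSubsets (outside ∷ S) = ∈-++⁺ˡ (∈-map⁺ (outside ∷_) (∈-allSubsets S))
  ∈-allSubsets (inside ∷ S)  = ∈-++⁺ʳ _ (∈-map⁺ (inside ∷_) (∈-allSubsets S))

  ∑-allSubsets-suc : ∀ {v} (f : Subset (suc v) → ℕ) →
                     ∑ₗ (allSubsets (suc v)) f
                       ≡ ∑[ S ∈ allSubsets v ] f (outside ∷ S) + ∑[ S ∈ allSubsets v ] f (inside ∷ S)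
  ∑-allSubsets-suc {v} f = begin
    ∑ₗ (map (outside ∷_) L ++ map (inside ∷_) L) f  ≡⟨ ∑ₗ-++ (map (outside ∷_) L) _ f ⟩
    ∑ₗ (map (outside ∷_) L) f + ∑ₗ (map (inside ∷_) L) f  ≡⟨ cong₂ _+_ (∑ₗ-map _ L f) (∑ₗ-map _ L f) ⟩
    ∑[ S ∈ L ] f (outside ∷ S) + ∑[ S ∈ L ] f (inside ∷ S)  ∎
    where L = allSubsets v

  count-pos : ∀ {v} {P : Pred (Subset v) 0ℓ} (P? : Decidable P) {S : Subset v} → P S → 0 < count P P?
  count-pos P? {S} pS = filter-some P? (lose (∈-allSubsets S) pS)

  between : ∀ {v} → Subset v → Subset v → ℕ → Subset v → ℕ
  between X Z n Y = 𝟙 (∣ Y ∣ ≟ n) * 𝟙 (X ⊆? Y) * 𝟙 (Y ⊆? Z)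

  module _ {v} (X Z : Subset v) (n : ℕ) where

    between-⊉ : ∀ Y → ¬ X ⊆ Y → between X Z n Y ≡ 0
    between-⊉ Y X⊈Y = begin
      𝟙 (∣ Y ∣ ≟ n) * 𝟙 (X ⊆? Y) * 𝟙 (Y ⊆? Z)  ≡⟨ cong (λ b → 𝟙 (∣ Y ∣ ≟ n) * b * 𝟙 (Y ⊆? Z)) (𝟙-no (X ⊆? Y) X⊈Y) ⟩
      𝟙 (∣ Y ∣ ≟ n) * 0 * 𝟙 (Y ⊆? Z)           ≡⟨ cong (_* 𝟙 (Y ⊆? Z)) (*-zeroʳ (𝟙 (∣ Y ∣ ≟ n))) ⟩
      0                                        ∎

    between-⊈ : ∀ Y → ¬ Y ⊆ Z → between X Z n Y ≡ 0
    between-⊈ Y Y⊈Z = cong (𝟙 (∣ Y ∣ ≟ n) * 𝟙 (X ⊆? Y) *_) (𝟙-no (Y ⊆? Z) Y⊈Z) ⟨ trans ⟩ *-zeroʳ (𝟙 (∣ Y ∣ ≟ n) * 𝟙 (X ⊆? Y))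

  layer : ∀ {v} → Subset v → Subset v → ℕ → ℕ
  layer {v} X Z m = ∑[ Y ∈ allSubsets v ] between X Z (m + ∣ X ∣) Y

  layer-∷ : ∀ {v} s t (X Z : Subset v) m →
            layer (s ∷ X) (t ∷ Z) m
              ≡ ∑[ Y ∈ allSubsets v ] between (s ∷ X) (t ∷ Z) (m + ∣ s ∷ X ∣) (outside ∷ Y)
                + ∑[ Y ∈ allSubsets v ] between (s ∷ X) (t ∷ Z) (m + ∣ s ∷ X ∣) (inside ∷ Y)
  layer-∷ s t X Z m = ∑-allSubsets-suc (between (s ∷ X) (t ∷ Z) (m + ∣ s ∷ X ∣))

  inside⊈outside : ∀ {v} {X Y : Subset v} → ¬ inside ∷ X ⊆ outside ∷ Y
  inside⊈outside i⊆o = case i⊆o here of λ ()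

  module _ {v} (X Z : Subset v) where

    layer-outside-outside : ∀ m → layer (outside ∷ X) (outside ∷ Z) m ≡ layer X Z m
    layer-outside-outside m = begin
      layer (outside ∷ X) (outside ∷ Z) m
        ≡⟨ layer-∷ outside outside X Z m ⟩
      layer X Z m + ∑[ Y ∈ L ] between (outside ∷ X) (outside ∷ Z) n (inside ∷ Y)
        ≡⟨ cong (layer X Z m +_) (∑ₗ-zero L (λ Y → between-⊈ (outside ∷ X) (outside ∷ Z) n (inside ∷ Y) inside⊈outside)) ⟩
      layer X Z m + 0
        ≡⟨ +-identityʳ _ ⟩
      layer X Z m ∎
      where
      L = allSubsets v
      n = m + ∣ X ∣

    layer-outside-inside-zero : layer (outside ∷ X) (inside ∷ Z) 0 ≡ layer X Z 0
    layer-outside-inside-zero = begin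
      layer (outside ∷ X) (inside ∷ Z) 0
        ≡⟨ layer-∷ outside inside X Z 0 ⟩
      layer X Z 0 + ∑[ Y ∈ L ] between (outside ∷ X) (inside ∷ Z) ∣ X ∣ (inside ∷ Y)
        ≡⟨ cong (layer X Z 0 +_) (∑ₗ-zero L too-small) ⟩
      layer X Z 0 + 0
        ≡⟨ +-identityʳ _ ⟩
      layer X Z 0 ∎
      where
      L = allSubsets v
      X⊈Y : ∀ {Y} → suc ∣ Y ∣ ≡ ∣ X ∣ → 𝟙 (X ⊆? Y) ≡ 0
      X⊈Y {Y} e = 𝟙-no (X ⊆? Y) (λ X⊆Y → 1+n≰n (≤-trans (≤-reflexive e) (p⊆q⇒∣p∣≤∣q∣ X⊆Y)))
      too-small : ∀ Y → between (outside ∷ X) (inside ∷ Z) ∣ X ∣ (inside ∷ Y) ≡ 0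
      too-small Y = cong (_* 𝟙 (Y ⊆? Z))
        (𝟙-*-cong (suc ∣ Y ∣ ≟ ∣ X ∣) X⊈Y ⟨ trans ⟩ *-zeroʳ (𝟙 (suc ∣ Y ∣ ≟ ∣ X ∣)))

    layer-outside-inside-suc : ∀ m → layer (outside ∷ X) (inside ∷ Z) (suc m) ≡ layer X Z (suc m) + layer X Z m
    layer-outside-inside-suc m = layer-∷ outside inside X Z (suc m)

    layer-inside-inside : ∀ m → layer (inside ∷ X) (inside ∷ Z) m ≡ layer X Z m
    layer-inside-inside m = begin
      layer (inside ∷ X) (inside ∷ Z) m
        ≡⟨ layer-∷ inside inside X Z m ⟩
      ∑[ Y ∈ L ] between (inside ∷ X) (inside ∷ Z) n (outside ∷ Y)
        + ∑[ Y ∈ L ] between (inside ∷ X) (inside ∷ Z) n (inside ∷ Y)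
        ≡⟨ cong₂ _+_ (∑ₗ-zero L (λ Y → between-⊉ (inside ∷ X) (inside ∷ Z) n (outside ∷ Y) inside⊈outside))
                     (∑ₗ-cong L (λ Y → cong (λ k → between (inside ∷ X) (inside ∷ Z) k (inside ∷ Y)) (+-suc m ∣ X ∣))) ⟩
      0 + layer X Z m ∎
      where
      L = allSubsets v
      n = m + suc ∣ X ∣

  layer-binomial : ∀ {v} {X Z : Subset v} → X ⊆ Z → ∀ m → layer X Z m ≡ (∣ Z ∣ ∸ ∣ X ∣) C m
  layer-binomial {zero} {[]} {[]} _ zero    = refl
  layer-binomial {zero} {[]} {[]} _ (suc m) = refl
  layer-binomial {suc v} {outside ∷ X} {outside ∷ Z} X⊆Z m =
    layer-outside-outside X Z m ⟨ trans ⟩ layer-binomial (drop-∷-⊆ X⊆Z) m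
  layer-binomial {suc v} {outside ∷ X} {inside ∷ Z} X⊆Z zero =
    layer-outside-inside-zero X Z ⟨ trans ⟩ layer-binomial (drop-∷-⊆ X⊆Z) 0
  layer-binomial {suc v} {outside ∷ X} {inside ∷ Z} X⊆Z (suc m) = begin
    layer (outside ∷ X) (inside ∷ Z) (suc m)
      ≡⟨ layer-outside-inside-suc X Z m ⟩
    layer X Z (suc m) + layer X Z m
      ≡⟨ cong₂ _+_ (layer-binomial X⊆Z′ (suc m)) (layer-binomial X⊆Z′ m) ⟩
    d C suc m + d C m
      ≡⟨ +-comm (d C suc m) _ ⟩
    d C m + d C suc m
      ≡⟨ nCk+nC[k+1]≡[n+1]C[k+1] d m ⟩
    suc d C suc m
      ≡⟨ cong (_C suc m) (+-∸-assoc 1 (p⊆q⇒∣p∣≤∣q∣ X⊆Z′)) ⟨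
    (suc ∣ Z ∣ ∸ ∣ X ∣) C suc m ∎
    where
    X⊆Z′ = drop-∷-⊆ X⊆Z
    d = ∣ Z ∣ ∸ ∣ X ∣
  layer-binomial {suc v} {inside ∷ X} {outside ∷ Z} X⊆Z m = contradiction (λ {x} → X⊆Z {x}) inside⊈outside
  layer-binomial {suc v} {inside ∷ X} {inside ∷ Z} X⊆Z m =
    layer-inside-inside X Z m ⟨ trans ⟩ layer-binomial (drop-∷-⊆ X⊆Z) m

  layer-⊈ : ∀ {v} {X Z : Subset v} → ¬ X ⊆ Z → ∀ m → layer X Z m ≡ 0
  layer-⊈ {v} {X} {Z} X⊈Z m = ∑ₗ-zero (allSubsets v) vanish
    where
    vanish : ∀ Y → between X Z (m + ∣ X ∣) Y ≡ 0
    vanish Y = case X ⊆? Y of λ where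
      (yes X⊆Y) → between-⊈ X Z _ Y (λ Y⊆Z → X⊈Z (⊆-trans X⊆Y Y⊆Z))
      (no  X⊈Y) → between-⊉ X Z _ Y X⊈Y

  layer≡𝟙*C : ∀ {v} (X Z : Subset v) m → layer X Z m ≡ 𝟙 (X ⊆? Z) * ((∣ Z ∣ ∸ ∣ X ∣) C m)
  layer≡𝟙*C X Z m with X ⊆? Z
  ... | yes X⊆Z = layer-binomial X⊆Z m ⟨ trans ⟩ sym (*-identityˡ _)
  ... | no  X⊈Z = layer-⊈ X⊈Z m

  module _ {v} {𝒵 : Pred (Subset v) 0ℓ} (𝒵? : Decidable 𝒵) where

    supersets : Subset v → ℕ
    supersets Y = ∑[ Z ∈ allSubsets v ] (𝟙 (𝒵? Z) * 𝟙 (Y ⊆? Z))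

    ∑-supersets : ∀ {z} → (∀ {Z} → 𝒵 Z → ∣ Z ∣ ≡ z) → ∀ X m →
                  ∑[ Y ∈ allSubsets v ] (𝟙 (∣ Y ∣ ≟ m + ∣ X ∣) * (𝟙 (X ⊆? Y) * supersets Y))
                    ≡ ((z ∸ ∣ X ∣) C m) * supersets X
    ∑-supersets {z} ∣𝒵∣≡z X m = begin
      ∑[ Y ∈ L ] (𝟙 (∣ Y ∣ ≟ n) * (𝟙 (X ⊆? Y) * supersets Y))
        ≡⟨ ∑ₗ-cong L expand ⟩
      ∑[ Y ∈ L ] ∑[ Z ∈ L ] (𝟙 (𝒵? Z) * between X Z n Y)
        ≡⟨ ∑ₗ-comm L L _ ⟩
      ∑[ Z ∈ L ] ∑[ Y ∈ L ] (𝟙 (𝒵? Z) * between X Z n Y)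
        ≡⟨ ∑ₗ-cong L (λ Z → *-distribˡ-∑ₗ L (between X Z n) (𝟙 (𝒵? Z))) ⟨
      ∑[ Z ∈ L ] (𝟙 (𝒵? Z) * layer X Z m)
        ≡⟨ ∑ₗ-cong L (λ Z → 𝟙-*-cong (𝒵? Z) (λ 𝒵Z → layer-in-𝒵 Z (∣𝒵∣≡z 𝒵Z))) ⟩
      ∑[ Z ∈ L ] (𝟙 (𝒵? Z) * (𝟙 (X ⊆? Z) * c))
        ≡⟨ ∑ₗ-cong L (λ Z → *-assoc (𝟙 (𝒵? Z)) (𝟙 (X ⊆? Z)) c) ⟨
      ∑[ Z ∈ L ] (𝟙 (𝒵? Z) * 𝟙 (X ⊆? Z) * c)
        ≡⟨ *-distribʳ-∑ₗ L (λ Z → 𝟙 (𝒵? Z) * 𝟙 (X ⊆? Z)) c ⟨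
      supersets X * c
        ≡⟨ *-comm (supersets X) c ⟩
      c * supersets X ∎
      where
      open +-*-Solver
      L = allSubsets v
      n = m + ∣ X ∣
      c = (z ∸ ∣ X ∣) C m
      expand : ∀ Y → 𝟙 (∣ Y ∣ ≟ n) * (𝟙 (X ⊆? Y) * supersets Y)
                     ≡ ∑[ Z ∈ L ] (𝟙 (𝒵? Z) * between X Z n Y)
      expand Y = begin
        a * (b * supersets Y)                       ≡⟨ *-assoc a b _ ⟨
        a * b * supersets Y                         ≡⟨ *-distribˡ-∑ₗ L _ (a * b) ⟩
        ∑[ Z ∈ L ] (a * b * (𝟙 (𝒵? Z) * 𝟙 (Y ⊆? Z)))  ≡⟨ ∑ₗ-cong L (λ Z → rearrange a b (𝟙 (𝒵? Z)) (𝟙 (Y ⊆? Z))) ⟩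
        ∑[ Z ∈ L ] (𝟙 (𝒵? Z) * between X Z n Y)      ∎
        where
        a = 𝟙 (∣ Y ∣ ≟ n)
        b = 𝟙 (X ⊆? Y)
        rearrange : ∀ a b c d → a * b * (c * d) ≡ c * (a * b * d)
        rearrange = solve 4 (λ a b c d → a :* b :* (c :* d) := c :* (a :* b :* d)) refl
      layer-in-𝒵 : ∀ Z → ∣ Z ∣ ≡ z → layer X Z m ≡ 𝟙 (X ⊆? Z) * c
      layer-in-𝒵 Z ∣Z∣≡z = layer≡𝟙*C X Z m ⟨ trans ⟩ cong (λ k → 𝟙 (X ⊆? Z) * ((k ∸ ∣ X ∣) C m)) ∣Z∣≡z

  module _ {v} (𝔓 : PartitionSeq v) where
    open PartitionSeq 𝔓

    ∈Part⇒size : ∀ {S k i} → S ∈Part (k , i) → ∣ S ∣ ≡ k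
    ∈Part⇒size {S} {k} with ∣ S ∣ ≟ k
    ... | yes ∣S∣≡k = λ _ → ∣S∣≡k
    ... | no  _     = λ ()

    ∑-𝟙-∈Part : ∀ (Y : Subset v) y → ∑[ j < nParts y ] 𝟙 (Y ∈Part? (y , j)) ≡ 𝟙 (∣ Y ∣ ≟ y)
    ∑-𝟙-∈Part Y y with ∣ Y ∣ ≟ y
    ... | yes refl  = ∑-𝟙-≟ (cls Y) ⟨ trans ⟩ sym (𝟙-yes (∣ Y ∣ ≟ ∣ Y ∣) refl)
    ... | no  ∣Y∣≢y = sum-replicate-zero (nParts y) ⟨ trans ⟩ sym (𝟙-no (∣ Y ∣ ≟ y) ∣Y∣≢y)

    upCount≡supersets : ∀ X y j → upCount X y j ≡ supersets (_∈Part? (y , j)) X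
    upCount≡supersets X y j = length-filter≡∑ₗ _ (allSubsets v)
      ⟨ trans ⟩ ∑ₗ-cong (allSubsets v) (λ Y → 𝟙-× (Y ∈Part? (y , j)) (X ⊆? Y))

    partSize-pos : ∀ k i → 0 < partSize k i
    partSize-pos k i = count-pos (_∈Part? (k , i)) (proj₂ (nonempty k i))

    module _ (tactical : IsTactical 𝔓) where
      open IsTactical tactical

      R≡upCount : ∀ {y z} → y ≤ z → ∀ {Y j} k → Y ∈Part (y , j) → R y z j k ≡ upCount Y z k
      R≡upCount {y} {z} y≤z {Y} {j} k Y∈j = up-const y z y≤z j k (rep y j) Y (proj₂ (nonempty y j)) Y∈j

      ∑-upCount*R : ∀ {y z} → y ≤ z → ∀ X k →
                    ∑[ j < nParts y ] (upCount X y j * R y z j k)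
                      ≡ ∑[ Y ∈ allSubsets v ] (𝟙 (∣ Y ∣ ≟ y) * (𝟙 (X ⊆? Y) * upCount Y z k))
      ∑-upCount*R {y} {z} y≤z X k = begin
        ∑[ j < nParts y ] (upCount X y j * R y z j k)
          ≡⟨ sum-cong-≗ (λ j → cong (_* R y z j k) (upCount≡supersets X y j)
                                ⟨ trans ⟩ *-distribʳ-∑ₗ L _ (R y z j k)) ⟩
        ∑[ j < nParts y ] ∑[ Y ∈ L ] (𝟙 (Y ∈Part? (y , j)) * 𝟙 (X ⊆? Y) * R y z j k)
          ≡⟨ sum-cong-≗ (λ j → ∑ₗ-cong L (λ Y → *-assoc (𝟙 (Y ∈Part? (y , j))) _ _
                                ⟨ trans ⟩ 𝟙-*-cong (Y ∈Part? (y , j)) (cong (𝟙 (X ⊆? Y) *_) ∘ R≡upCount y≤z k))) ⟩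
        ∑[ j < nParts y ] ∑[ Y ∈ L ] (𝟙 (Y ∈Part? (y , j)) * g Y)
          ≡⟨ ∑-∑ₗ-comm (nParts y) L _ ⟩
        ∑[ Y ∈ L ] ∑[ j < nParts y ] (𝟙 (Y ∈Part? (y , j)) * g Y)
          ≡⟨ ∑ₗ-cong L (λ Y → *-distribʳ-sum (g Y) (λ j → 𝟙 (Y ∈Part? (y , j)))) ⟨
        ∑[ Y ∈ L ] ((∑[ j < nParts y ] 𝟙 (Y ∈Part? (y , j))) * g Y)
          ≡⟨ ∑ₗ-cong L (λ Y → cong (_* g Y) (∑-𝟙-∈Part Y y)) ⟩
        ∑[ Y ∈ L ] (𝟙 (∣ Y ∣ ≟ y) * g Y) ∎
        where
        L = allSubsets v
        g : Subset v → ℕ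
        g Y = 𝟙 (X ⊆? Y) * upCount Y z k

      ∑-R*R : ∀ {x y z} → x ≤ y → y ≤ z → ∀ i k →
              ∑[ j < nParts y ] (R x y i j * R y z j k) ≡ ((z ∸ x) C (y ∸ x)) * R x z i k
      ∑-R*R {x} {y} {z} x≤y y≤z i k = begin
        ∑[ j < nParts y ] (upCount X y j * R y z j k)
          ≡⟨ ∑-upCount*R y≤z X k ⟩
        ∑[ Y ∈ L ] (𝟙 (∣ Y ∣ ≟ y) * (𝟙 (X ⊆? Y) * upCount Y z k))
          ≡⟨ ∑ₗ-cong L (λ Y → cong₂ (λ n u → 𝟙 (∣ Y ∣ ≟ n) * (𝟙 (X ⊆? Y) * u)) y≡ (upCount≡supersets Y z k)) ⟩
        ∑[ Y ∈ L ] (𝟙 (∣ Y ∣ ≟ (y ∸ x) + ∣ X ∣) * (𝟙 (X ⊆? Y) * supersets 𝒵? Y))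
          ≡⟨ ∑-supersets 𝒵? ∈Part⇒size X (y ∸ x) ⟩
        ((z ∸ ∣ X ∣) C (y ∸ x)) * supersets 𝒵? X
          ≡⟨ cong₂ (λ a b → ((z ∸ a) C (y ∸ x)) * b) ∣X∣≡x (sym (upCount≡supersets X z k)) ⟩
        ((z ∸ x) C (y ∸ x)) * R x z i k ∎
        where
        L = allSubsets v
        X = rep x i
        𝒵? = _∈Part? (z , k)
        ∣X∣≡x : ∣ X ∣ ≡ x
        ∣X∣≡x = ∈Part⇒size (proj₂ (nonempty x i))
        y≡ : y ≡ (y ∸ x) + ∣ X ∣
        y≡ = sym (m∸n+n≡m x≤y) ⟨ trans ⟩ cong ((y ∸ x) +_) (sym ∣X∣≡x)

open Counting using (∑-R*R; partSize-pos)

module _ {c ℓ} (Rg : CommutativeRing c ℓ) where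
  open CommutativeRing Rg
  open SemiringSum semiring using (sum)
  open SemiringMult semiring using (×-homo-+; ×1-homo-*)
  open CMSolver *-commutativeMonoid using (solve; _⊜_; _⊕_)
  open SetoidReasoning setoid

  ringℕ-sum : ∀ n (f : Fin n → ℕ) → ringℕ Rg (ℕΣ.sum f) ≈ sum (ringℕ Rg ∘ f)
  ringℕ-sum ℕ.zero    f = refl
  ringℕ-sum (ℕ.suc n) f = trans (×-homo-+ 1# (f Fin.zero) _) (+-congˡ (ringℕ-sum n (f ∘ Fin.suc)))

  module _ (sd : SqrtData Rg) {v} (𝔓 : PartitionSeq v) where
    open SqrtData sd
    open PartitionSeq 𝔓

    W*W≈ : ∀ {x y z} i j k →
           W Rg sd 𝔓 x y i j * W Rg sd 𝔓 y z j k
             ≈ sq (partSize x i) * ringℕ Rg (R x y i j ℕ.* R y z j k) * sqInv (partSize z k)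
    W*W≈ {x} {y} {z} i j k = begin
      (a * f * t) * (s * g * b)    ≈⟨ solve 6 (λ a f t s g b → ((a ⊕ f) ⊕ t) ⊕ ((s ⊕ g) ⊕ b)
                                                ⊜ ((a ⊕ (f ⊕ g)) ⊕ b) ⊕ (s ⊕ t)) refl a f t s g b ⟩
      (a * (f * g) * b) * (s * t)  ≈⟨ *-congˡ (sq-inv (partSize y j) (partSize-pos 𝔓 y j)) ⟩
      (a * (f * g) * b) * 1#       ≈⟨ *-identityʳ _ ⟩
      a * (f * g) * b              ≈⟨ *-congʳ (*-congˡ (×1-homo-* (R x y i j) (R y z j k))) ⟨
      a * ringℕ Rg (R x y i j ℕ.* R y z j k) * b ∎
      where
      a = sq (partSize x i)
      f = ringℕ Rg (R x y i j)
      t = sqInv (partSize y j)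
      s = sq (partSize y j)
      g = ringℕ Rg (R y z j k)
      b = sqInv (partSize z k)

lemma3p15 : ∀ {c ℓ} (Rg : CommutativeRing c ℓ) (sd : SqrtData Rg)
    (v : ℕ) (𝔓 : PartitionSeq v) → IsTactical 𝔓 →
    (x y z : ℕ) → x ≤ y → y ≤ z → z ≤ v →
    (i : Fin (PartitionSeq.nParts 𝔓 x)) (k : Fin (PartitionSeq.nParts 𝔓 z)) →
    CommutativeRing._≈_ Rg (WW Rg sd 𝔓 x y z i k)
      (CommutativeRing._*_ Rg
        (ringℕ Rg ((z ∸ x) C (y ∸ x)))
        (W Rg sd 𝔓 x z i k))
lemma3p15 Rg sd v 𝔓 tactical x y z x≤y y≤z _ i k = begin
  sum (λ j → W Rg sd 𝔓 x y i j * W Rg sd 𝔓 y z j k)  ≈⟨ sum-cong-≋ (λ j → W*W≈ Rg sd 𝔓 i j k) ⟩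
  sum (λ j → a * ringℕ Rg (r j) * b)                  ≈⟨ *-distribʳ-sum b (λ j → a * ringℕ Rg (r j)) ⟨
  sum (λ j → a * ringℕ Rg (r j)) * b                  ≈⟨ *-congʳ (*-distribˡ-sum a (ringℕ Rg ∘ r)) ⟨
  a * sum (ringℕ Rg ∘ r) * b                          ≈⟨ *-congʳ (*-congˡ (ringℕ-sum Rg _ r)) ⟨
  a * ringℕ Rg (ℕΣ.sum r) * b                         ≈⟨ *-congʳ (*-congˡ (reflexive (cong (ringℕ Rg) (∑-R*R 𝔓 tactical x≤y y≤z i k)))) ⟩
  a * ringℕ Rg (binom ℕ.* R x z i k) * b              ≈⟨ *-congʳ (*-congˡ (×1-homo-* binom (R x z i k))) ⟩
  a * (ringℕ Rg binom * ringℕ Rg (R x z i k)) * b     ≈⟨ solve 4 (λ a c r b → (a ⊕ (c ⊕ r)) ⊕ b ⊜ c ⊕ ((a ⊕ r) ⊕ b))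
                                                               refl a (ringℕ Rg binom) (ringℕ Rg (R x z i k)) b ⟩
  ringℕ Rg binom * (a * ringℕ Rg (R x z i k) * b)     ∎
  where
  open CommutativeRing Rg
  open SemiringSum semiring using (sum; sum-cong-≋; *-distribˡ-sum; *-distribʳ-sum)
  open SemiringMult semiring using (×1-homo-*)
  open CMSolver *-commutativeMonoid using (solve; _⊜_; _⊕_)
  open SetoidReasoning setoid
  open SqrtData sd
  open PartitionSeq 𝔓
  a = sq (partSize x i)
  b = sqInv (partSize z k)
  r : Fin (nParts y) → ℕ
  r j = R x y i j ℕ.* R y z j k
  binom = (z ∸ x) C (y ∸ x)
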